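{- Let $G$ be a connected graph and let $E_{V(G)}$ be the set of vertices of $G$ of even degree in $G$. Then $\gamma_{coe}(G\circ K_1)=|V(G)|+|E_{V(G)}|$.
   Context: All graphs are finite and simple. A dominating set of a graph $X=(V,E)$ is a set $D\subseteq V$ such that every vertex in $V\setminus D$ is adjacent to at least one vertex of $D$. A dominating set $D$ is a co-even dominating set if every vertex $v\in V\setminus D$ has even degree in $X$. The co-even domination number $\gamma_{coe}(X)$ is the minimum cardinality of a co-even dominating set of $X$. The corona $G\circ K_1$ is the graph obtained from $G$ by adding, for each vertex $v\in V(G)$, a new vertex $v'$ and the pendant edge $vv'$. -}

module Defs where

open import Data.Nat using (ℕ; _+_; _≤_)
open import Data.Nat.Divisibility using (_∣_; _∣?_)
open import Data.Bool using (Bool; true; false)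
open import Data.Fin using (Fin; splitAt; _≟_)
open import Data.Fin.Subset using (Subset; _∈_; _∉_; ∣_∣)
open import Data.List using (List; length; filter; allFin)
open import Data.Sum using (_⊎_; inj₁; inj₂)
open import Data.Product using (Σ; _×_; _,_)
open import Relation.Nullary.Decidable using (⌊_⌋; yes; no)
open import Relation.Binary.PropositionalEquality using (_≡_; refl; sym)

record Graph : Set where
  field
    n      : ℕ
    adj    : Fin n → Fin n → Bool
    adj-sym    : ∀ i j → adj i j ≡ adj j i
    adj-irrefl : ∀ i → adj i i ≡ false
open Graph public

degree : (G : Graph) → Fin (n G) → ℕ
degree G v = length (filter (λ j → Data.Bool._≟_ (adj G v j) true) (allFin (n G)))
  where import Data.Bool

evenDegreeVertices : (G : Graph) → List (Fin (n G))
evenDegreeVertices G = filter (λ v → 2 ∣? degree G v) (allFin (n G))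

data Walk (G : Graph) : Fin (n G) → Fin (n G) → Set where
  here : ∀ {u} → Walk G u u
  step : ∀ {u v w} → adj G u v ≡ true → Walk G v w → Walk G u w

Connected : Graph → Set
Connected G = ∀ u v → Walk G u v

IsDominating : (G : Graph) → Subset (n G) → Set
IsDominating G D = ∀ v → v ∉ D → Σ (Fin (n G)) (λ u → u ∈ D × adj G v u ≡ true)

IsCoEvenDominating : (G : Graph) → Subset (n G) → Set
IsCoEvenDominating G D = IsDominating G D × (∀ v → v ∉ D → 2 ∣ degree G v)

IsCoEvenDominationNumber : (G : Graph) → ℕ → Set
IsCoEvenDominationNumber G k =
  Σ (Subset (n G)) (λ D → IsCoEvenDominating G D × ∣ D ∣ ≡ k)
  × (∀ D → IsCoEvenDominating G D → k ≤ ∣ D ∣)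

-- corona G ∘ K₁: vertex set Fin (n + n); splitAt n sends i to inj₁ v
-- (original vertex v) or inj₂ v (the new pendant vertex v').
eqb : ∀ {m} → Fin m → Fin m → Bool
eqb a b = ⌊ a ≟ b ⌋

eqb-sym : ∀ {m} (a b : Fin m) → eqb a b ≡ eqb b a
eqb-sym a b with a ≟ b | b ≟ a
... | yes _ | yes _ = refl
... | no _  | no _  = refl
... | yes p | no q  with q (sym p)
... | ()
eqb-sym a b | no p | yes q with p (sym q)
... | ()

coronaAdj : (G : Graph) → (Fin (n G) ⊎ Fin (n G)) → (Fin (n G) ⊎ Fin (n G)) → Bool
coronaAdj G (inj₁ a) (inj₁ b) = adj G a b
coronaAdj G (inj₁ a) (inj₂ b) = eqb a b
coronaAdj G (inj₂ a) (inj₁ b) = eqb a b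
coronaAdj G (inj₂ a) (inj₂ b) = false

coronaAdj-sym : (G : Graph) → ∀ x y → coronaAdj G x y ≡ coronaAdj G y x
coronaAdj-sym G (inj₁ a) (inj₁ b) = adj-sym G a b
coronaAdj-sym G (inj₁ a) (inj₂ b) = eqb-sym a b
coronaAdj-sym G (inj₂ a) (inj₁ b) = eqb-sym a b
coronaAdj-sym G (inj₂ a) (inj₂ b) = refl

coronaAdj-irrefl : (G : Graph) → ∀ x → coronaAdj G x x ≡ false
coronaAdj-irrefl G (inj₁ a) = adj-irrefl G a
coronaAdj-irrefl G (inj₂ a) = refl

corona : Graph → Graph
corona G = record
  { n = n G + n G
  ; adj = λ i j → coronaAdj G (splitAt (n G) i) (splitAt (n G) j)
  ; adj-sym = λ i j → coronaAdj-sym G (splitAt (n G) i) (splitAt (n G) j)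
  ; adj-irrefl = λ i → coronaAdj-irrefl G (splitAt (n G) i)
  }

module Submission where

-- In G ∘ K₁ every pendant vertex v′ has degree 1 and every original vertex v has
-- degree deg_G(v) + 1.  A co-even dominating set must therefore contain all n
-- pendant vertices (odd degree) and every original vertex of even G-degree.
-- Conversely these vertices already form a co-even dominating set: each remaining
-- vertex v has odd G-degree, hence even corona degree, and is dominated by v′.

open import Defs
open import Data.Nat using (ℕ; zero; suc; _+_)
open import Data.Nat.Properties using (+-comm)
open import Data.Nat.Divisibility using (_∣_; _∣?_; _∣0; ∣-refl; ∣1⇒≡1; ∣m+n∣m⇒∣n; ∣m∣n⇒∣m+n)
open import Data.Bool using (true; false)
import Data.Bool as Bool
open import Data.Fin using (Fin; zero; suc; splitAt; _↑ˡ_; _↑ʳ_)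
import Data.Fin as Fin
open import Data.Fin.Properties using (splitAt-↑ˡ; splitAt-↑ʳ; splitAt⁻¹-↑ˡ; splitAt⁻¹-↑ʳ)
open import Data.Fin.Subset using (Subset; _∈_; _∉_; _⊆_; ∣_∣; ⊤; ⊥; ⁅_⁆)
open import Data.Fin.Subset.Properties using (_∈?_; ∈⊤; ∣⊤∣≡n; ∣⊥∣≡0; ∣⁅x⁆∣≡1; p⊆q⇒∣p∣≤∣q∣)
open import Data.List using (length; filter; allFin)
import Data.List as List
open import Data.Vec using (Vec; []; _∷_; tabulate; _++_; _[_]=_; here; there)
open import Data.Vec.Properties
  using (tabulate-cong; tabulate-allFin; map-const; lookup∘tabulate; []=⇒lookup; lookup⇒[]=)
open import Data.Sum using (inj₁; inj₂)
open import Data.Product using (_,_)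
open import Function using (_∘_)
open import Level using (Level)
open import Relation.Nullary using (¬_; Dec; does; yes; no; contradiction)
open import Relation.Nullary.Decidable using (dec-true; isYes≗does; ⌊⌋-map′)
open import Relation.Unary using (Pred; Decidable)
open import Relation.Binary.PropositionalEquality
  using (_≡_; refl; sym; trans; cong; cong₂; subst; module ≡-Reasoning)

open ≡-Reasoning

private
  variable
    ℓ : Level
    A : Set
    m k : ℕ

¬2∣1 : ¬ (2 ∣ 1)
¬2∣1 2∣1 with ∣1⇒≡1 2∣1
... | ()

2∣n⇒¬2∣1+n : ∀ {n} → 2 ∣ n → ¬ (2 ∣ suc n)
2∣n⇒¬2∣1+n {n} 2∣n 2∣1+n = ¬2∣1 (∣m+n∣m⇒∣n (subst (2 ∣_) (+-comm 1 n) 2∣1+n) 2∣n)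

¬2∣n⇒2∣1+n : ∀ {n} → ¬ (2 ∣ n) → 2 ∣ suc n
¬2∣n⇒2∣1+n {zero}        ¬2∣0   = contradiction (2 ∣0) ¬2∣0
¬2∣n⇒2∣1+n {suc zero}    _      = ∣-refl
¬2∣n⇒2∣1+n {suc (suc n)} ¬2∣2+n = ∣m∣n⇒∣m+n ∣-refl (¬2∣n⇒2∣1+n (¬2∣2+n ∘ ∣m∣n⇒∣m+n ∣-refl))

data SplitView (m k : ℕ) : Fin (m + k) → Set where
  left  : ∀ i → SplitView m k (i ↑ˡ k)
  right : ∀ j → SplitView m k (m ↑ʳ j)

splitView : ∀ m k (x : Fin (m + k)) → SplitView m k x
splitView m k x with splitAt m x in eq
... | inj₁ i = subst (SplitView m k) (splitAt⁻¹-↑ˡ eq) (left i)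
... | inj₂ j = subst (SplitView m k) (splitAt⁻¹-↑ʳ eq) (right j)

tabulate-+ : (f : Fin (m + k) → A) →
             tabulate f ≡ tabulate (f ∘ (_↑ˡ k)) ++ tabulate (f ∘ (m ↑ʳ_))
tabulate-+ {zero}  f = refl
tabulate-+ {suc m} f = cong (f zero ∷_) (tabulate-+ {m = m} (f ∘ suc))

[]=-++⁺ˡ : ∀ {xs : Vec A m} {ys : Vec A k} {i x} → xs [ i ]= x → xs ++ ys [ i ↑ˡ k ]= x
[]=-++⁺ˡ here      = here
[]=-++⁺ˡ (there h) = there ([]=-++⁺ˡ h)

[]=-++⁻ˡ : ∀ (xs : Vec A m) {ys : Vec A k} i {x} → xs ++ ys [ i ↑ˡ k ]= x → xs [ i ]= x
[]=-++⁻ˡ (_ ∷ _)  zero    here      = here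
[]=-++⁻ˡ (_ ∷ xs) (suc i) (there h) = there ([]=-++⁻ˡ xs i h)

[]=-++⁺ʳ : ∀ (xs : Vec A m) {ys : Vec A k} {j x} → ys [ j ]= x → xs ++ ys [ m ↑ʳ j ]= x
[]=-++⁺ʳ []       h = h
[]=-++⁺ʳ (_ ∷ xs) h = there ([]=-++⁺ʳ xs h)

∣p++q∣≡∣p∣+∣q∣ : (p : Subset m) (q : Subset k) → ∣ p ++ q ∣ ≡ ∣ p ∣ + ∣ q ∣
∣p++q∣≡∣p∣+∣q∣ []          q = refl
∣p++q∣≡∣p∣+∣q∣ (true  ∷ p) q = cong suc (∣p++q∣≡∣p∣+∣q∣ p q)
∣p++q∣≡∣p∣+∣q∣ (false ∷ p) q = ∣p++q∣≡∣p∣+∣q∣ p q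

tabulate-false≡⊥ : tabulate {n = k} (λ _ → false) ≡ ⊥
tabulate-false≡⊥ = trans (tabulate-allFin _) (map-const _ false)

tabulate-eqb≡⁅⁆ : (v : Fin k) → tabulate (eqb v) ≡ ⁅ v ⁆
tabulate-eqb≡⁅⁆ zero    = cong (true ∷_) tabulate-false≡⊥
tabulate-eqb≡⁅⁆ (suc v) = cong (false ∷_) (trans (tabulate-cong λ x → ⌊⌋-map′ _ _ (v Fin.≟ x)) (tabulate-eqb≡⁅⁆ v))

length-filter-tabulate : ∀ {P : Pred A ℓ} (P? : Decidable P) (f : Fin m → A) →
  length (filter P? (List.tabulate f)) ≡ ∣ tabulate (does ∘ P? ∘ f) ∣
length-filter-tabulate {m = zero}  P? f = refl
length-filter-tabulate {m = suc m} P? f with does (P? (f zero))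
... | true  = cong suc (length-filter-tabulate P? (f ∘ suc))
... | false = length-filter-tabulate P? (f ∘ suc)

subsetOf : {P : Pred (Fin k) ℓ} → Decidable P → Subset k
subsetOf P? = tabulate (does ∘ P?)

module _ {P : Pred (Fin k) ℓ} (P? : Decidable P) where

  ∈-subsetOf⁺ : ∀ {x} → P x → x ∈ subsetOf P?
  ∈-subsetOf⁺ {x} px = lookup⇒[]= x _ (trans (lookup∘tabulate _ x) (dec-true (P? x) px))

  ∈-subsetOf⁻ : ∀ {x} → x ∈ subsetOf P? → P x
  ∈-subsetOf⁻ {x} x∈ = witness (P? x) (trans (sym (lookup∘tabulate _ x)) ([]=⇒lookup x∈))
    where
    witness : ∀ {B : Set ℓ} (b? : Dec B) → does b? ≡ true → B
    witness (yes b) _ = b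

  length-filter-allFin : length (filter P? (allFin k)) ≡ ∣ subsetOf P? ∣
  length-filter-allFin = length-filter-tabulate P? (λ x → x)

neighbourhood : (G : Graph) → Fin (n G) → Subset (n G)
neighbourhood G v = tabulate (adj G v)

degree≡∣neighbourhood∣ : (G : Graph) (v : Fin (n G)) → degree G v ≡ ∣ neighbourhood G v ∣
degree≡∣neighbourhood∣ G v =
  trans (length-filter-allFin (λ j → adj G v j Bool.≟ true)) (cong ∣_∣ (tabulate-cong (does-≟true ∘ adj G v)))
  where
  does-≟true : ∀ b → does (b Bool.≟ true) ≡ b
  does-≟true true  = refl
  does-≟true false = refl

module Corona (G : Graph) where

  corona-neighbourhood : ∀ {x s} → splitAt (n G) x ≡ s →
    neighbourhood (corona G) x ≡ tabulate (coronaAdj G s ∘ inj₁) ++ tabulate (coronaAdj G s ∘ inj₂)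
  corona-neighbourhood {x} refl = trans (tabulate-+ {m = n G} (adj (corona G) x))
    (cong₂ _++_ (tabulate-cong λ i → cong (coronaAdj G (splitAt (n G) x)) (splitAt-↑ˡ (n G) i (n G)))
                (tabulate-cong λ j → cong (coronaAdj G (splitAt (n G) x)) (splitAt-↑ʳ (n G) (n G) j)))

  degree-original : (v : Fin (n G)) → degree (corona G) (v ↑ˡ n G) ≡ suc (degree G v)
  degree-original v = begin
    degree (corona G) (v ↑ˡ n G)                ≡⟨ degree≡∣neighbourhood∣ (corona G) _ ⟩
    ∣ neighbourhood (corona G) (v ↑ˡ n G) ∣     ≡⟨ cong ∣_∣ (corona-neighbourhood (splitAt-↑ˡ (n G) v (n G))) ⟩
    ∣ neighbourhood G v ++ tabulate (eqb v) ∣  ≡⟨ ∣p++q∣≡∣p∣+∣q∣ (neighbourhood G v) _ ⟩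
    ∣ neighbourhood G v ∣ + ∣ tabulate (eqb v) ∣ ≡⟨ cong₂ _+_ (sym (degree≡∣neighbourhood∣ G v))
                                                          (trans (cong ∣_∣ (tabulate-eqb≡⁅⁆ v)) (∣⁅x⁆∣≡1 v)) ⟩
    degree G v + 1                              ≡⟨ +-comm _ 1 ⟩
    suc (degree G v)                            ∎

  degree-pendant : (v : Fin (n G)) → degree (corona G) (n G ↑ʳ v) ≡ 1
  degree-pendant v = begin
    degree (corona G) (n G ↑ʳ v)               ≡⟨ degree≡∣neighbourhood∣ (corona G) _ ⟩
    ∣ neighbourhood (corona G) (n G ↑ʳ v) ∣    ≡⟨ cong ∣_∣ (corona-neighbourhood (splitAt-↑ʳ (n G) (n G) v)) ⟩
    ∣ tabulate (eqb v) ++ tabulate (λ _ → false) ∣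
      ≡⟨ ∣p++q∣≡∣p∣+∣q∣ (tabulate (eqb v)) (tabulate {n = n G} (λ _ → false)) ⟩
    ∣ tabulate (eqb v) ∣ + ∣ tabulate {n = n G} (λ _ → false) ∣
      ≡⟨ cong₂ _+_ (trans (cong ∣_∣ (tabulate-eqb≡⁅⁆ v)) (∣⁅x⁆∣≡1 v))
                   (trans (cong ∣_∣ (tabulate-false≡⊥ {k = n G})) (∣⊥∣≡0 (n G))) ⟩
    1                                           ∎

  original-adj-pendant : (v : Fin (n G)) → adj (corona G) (v ↑ˡ n G) (n G ↑ʳ v) ≡ true
  original-adj-pendant v =
    trans (cong₂ (coronaAdj G) (splitAt-↑ˡ (n G) v (n G)) (splitAt-↑ʳ (n G) (n G) v))
          (trans (isYes≗does (v Fin.≟ v)) (dec-true (v Fin.≟ v) refl))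

isCoEvenDominationNumber : ∀ H D → IsCoEvenDominating H D →
  (∀ D′ → IsCoEvenDominating H D′ → D ⊆ D′) → IsCoEvenDominationNumber H ∣ D ∣
isCoEvenDominationNumber H D D-coEven D-least =
  (D , D-coEven , refl) , λ D′ D′-coEven → p⊆q⇒∣p∣≤∣q∣ (D-least D′ D′-coEven)

odd⇒∈coEvenDominating : ∀ H D x → IsCoEvenDominating H D → ¬ (2 ∣ degree H x) → x ∈ D
odd⇒∈coEvenDominating H D x (_ , coEven) odd with x ∈? D
... | yes x∈D = x∈D
... | no  x∉D = contradiction (coEven x x∉D) odd

module MinimumCoEvenSet (G : Graph) where
  open Corona G

  evenDegree? : Decidable (λ v → 2 ∣ degree G v)
  evenDegree? v = 2 ∣? degree G v

  evenDegreeSet : Subset (n G)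
  evenDegreeSet = subsetOf evenDegree?

  minimumCoEvenSet : Subset (n G + n G)
  minimumCoEvenSet = evenDegreeSet ++ ⊤ {n G}

  ∣minimumCoEvenSet∣ : ∣ minimumCoEvenSet ∣ ≡ n G + length (evenDegreeVertices G)
  ∣minimumCoEvenSet∣ = begin
    ∣ evenDegreeSet ++ ⊤ ∣               ≡⟨ ∣p++q∣≡∣p∣+∣q∣ evenDegreeSet (⊤ {n G}) ⟩
    ∣ evenDegreeSet ∣ + ∣ ⊤ {n G} ∣       ≡⟨ cong₂ _+_ (sym (length-filter-allFin evenDegree?)) (∣⊤∣≡n (n G)) ⟩
    length (evenDegreeVertices G) + n G ≡⟨ +-comm _ (n G) ⟩
    n G + length (evenDegreeVertices G) ∎

  minimumCoEvenSet-isCoEvenDominating : IsCoEvenDominating (corona G) minimumCoEvenSet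
  minimumCoEvenSet-isCoEvenDominating = dominating , coEven
    where
    pendant∈ : ∀ v → n G ↑ʳ v ∈ minimumCoEvenSet
    pendant∈ v = []=-++⁺ʳ evenDegreeSet ∈⊤

    dominating : IsDominating (corona G) minimumCoEvenSet
    dominating x x∉ with splitView (n G) (n G) x
    ... | left  v = n G ↑ʳ v , pendant∈ v , original-adj-pendant v
    ... | right v = contradiction (pendant∈ v) x∉

    coEven : ∀ x → x ∉ minimumCoEvenSet → 2 ∣ degree (corona G) x
    coEven x x∉ with splitView (n G) (n G) x
    ... | left  v = subst (2 ∣_) (sym (degree-original v))
                      (¬2∣n⇒2∣1+n (x∉ ∘ []=-++⁺ˡ ∘ ∈-subsetOf⁺ evenDegree?))
    ... | right v = contradiction (pendant∈ v) x∉

  minimumCoEvenSet-⊆ : ∀ D → IsCoEvenDominating (corona G) D → minimumCoEvenSet ⊆ D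
  minimumCoEvenSet-⊆ D D-coEven {x} x∈ with splitView (n G) (n G) x
  ... | left v = odd⇒∈coEvenDominating (corona G) D _ D-coEven λ 2∣deg →
        2∣n⇒¬2∣1+n (∈-subsetOf⁻ evenDegree? ([]=-++⁻ˡ evenDegreeSet v x∈))
                   (subst (2 ∣_) (degree-original v) 2∣deg)
  ... | right v = odd⇒∈coEvenDominating (corona G) D _ D-coEven λ 2∣deg →
        ¬2∣1 (subst (2 ∣_) (degree-pendant v) 2∣deg)

open MinimumCoEvenSet

theorem2p4 : (G : Graph) → Connected G →
    IsCoEvenDominationNumber (corona G) (n G + length (evenDegreeVertices G))
theorem2p4 G _ = subst (IsCoEvenDominationNumber (corona G)) (∣minimumCoEvenSet∣ G)
  (isCoEvenDominationNumber (corona G) (minimumCoEvenSet G)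
    (minimumCoEvenSet-isCoEvenDominating G) (minimumCoEvenSet-⊆ G))
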